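{- Let $G=(V,E)$ be a finite simple undirected graph, let $h$ be a positive integer, and let $H^{(n)}\mathrm{sup}(e)$ ($n\ge 0$, $e\in E$) be the higher-order H-index sequence defined below. Then for every positive integer $n$ and every edge $e\in E$, $H^{(n)}\mathrm{sup}(e)\ge H^{(n+1)}\mathrm{sup}(e)$.
   Context: $\mathrm{dist}_G$ is shortest-path distance in $G$. For a vertex $x$, $N_G(x,h)=\{y\neq x:\mathrm{dist}_G(x,y)\le h\}$. For an edge $e=(u,v)\in E$, the set of common $h$-neighbors is $\triangle_G(e,h)=N_G(u,h)\cap N_G(v,h)$ and the $h$-support is $\sup_G(e,h)=|\triangle_G(e,h)|$. For a finite multiset $M$ of nonnegative integers, $\mathcal{H}(M)$ is the largest integer $y\ge 0$ such that at least $y$ elements of $M$ are $\ge y$. Define $H^{(0)}\mathrm{sup}(e)=\sup_G(e,h)$ for all $e\in E$. For $n\ge 1$ and vertices $a,b$, let $P^{(n)}(a,b)=\max_{p}\min\{H^{(n-1)}\mathrm{sup}(f): f\text{ an edge of }p\}$, the maximum taken over all paths $p$ in $G$ from $a$ to $b$ with at most $h$ edges; and for $e=(u,v)\in E$ let $H^{(n)}\mathrm{sup}(e)=\mathcal{H}\big(\{\min(P^{(n)}(u,w),P^{(n)}(v,w)) : w\in\triangle_G(e,h)\}\big)$ (a multiset indexed by $w$). -}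

module Defs where

open import Data.Bool using (Bool; true; false; _∧_; _∨_; if_then_else_)
open import Data.Nat using (ℕ; zero; suc; _⊓_; _⊔_; _≤ᵇ_)
open import Data.Fin using (Fin)
import Data.Fin.Properties as FinP
open import Data.List using (List; []; _∷_; [_]; length; map; filter; filterᵇ; foldr; allFin; concatMap; last; upTo)
open import Data.Bool.ListAction using (any)
open import Data.Maybe using (Maybe; just; nothing)
open import Relation.Binary.PropositionalEquality using (_≡_)
open import Relation.Nullary.Decidable using (⌊_⌋; ¬?)
import Data.List.Relation.Unary.Unique.DecPropositional as UniqueDec

record Graph : Set where
  field
    N      : ℕ
    adj    : Fin N → Fin N → Bool
    adj-sym    : ∀ x y → adj x y ≡ adj y x
    adj-irrefl : ∀ x → adj x x ≡ false

module _ (G : Graph) (h : ℕ) where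
  open Graph G

  _==_ : Fin N → Fin N → Bool
  x == y = ⌊ x FinP.≟ y ⌋

  -- within k x y = true  iff  dist_G(x,y) ≤ k
  within : ℕ → Fin N → Fin N → Bool
  within zero    x y = x == y
  within (suc k) x y = within k x y ∨ any (λ z → adj x z ∧ within k z y) (allFin N)

  inNbhd : Fin N → Fin N → Bool
  inNbhd x y = (if x == y then false else true) ∧ within h x y

  -- △_G(e,h) for e = (u,v), as the list of its (distinct) elements
  common : Fin N → Fin N → List (Fin N)
  common u v = filterᵇ (λ w → inNbhd u w ∧ inNbhd v w) (allFin N)

  supp : Fin N → Fin N → ℕ
  supp u v = length (common u v)

  walksFrom : ℕ → Fin N → List (List (Fin N))
  walksFrom zero    a = [ a ] ∷ []
  walksFrom (suc k) a =
    [ a ] ∷ concatMap (λ z → if adj a z then map (a ∷_) (walksFrom k z) else []) (allFin N)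

  isLast : Fin N → List (Fin N) → Bool
  isLast b p with last p
  ... | just x  = x == b
  ... | nothing = false

  paths : Fin N → Fin N → List (List (Fin N))
  paths a b = filter (UniqueDec.unique? FinP._≟_)
                (filterᵇ (isLast b) (walksFrom h a))

  -- min of f over the edges of a path (vertex list); only used on paths with ≥ 1 edge
  bottleneck : (Fin N → Fin N → ℕ) → List (Fin N) → ℕ
  bottleneck f (x ∷ y ∷ []) = f x y
  bottleneck f (x ∷ y ∷ rest@(_ ∷ _)) = f x y ⊓ bottleneck f (y ∷ rest)
  bottleneck f _ = 0

  -- max over paths of length ≤ h from a to b of the bottleneck value
  -- (max over an empty family taken as 0; never used)
  Pfrom : (Fin N → Fin N → ℕ) → Fin N → Fin N → ℕ
  Pfrom f a b = foldr _⊔_ 0 (map (bottleneck f) (paths a b))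

  -- H-index of a finite multiset (list) of naturals:
  -- the largest y such that at least y elements are ≥ y (necessarily y ≤ length).
  countGe : ℕ → List ℕ → ℕ
  countGe y M = length (filterᵇ (y ≤ᵇ_) M)

  hIndex : List ℕ → ℕ
  hIndex M = foldr _⊔_ 0 (map (λ y → if y ≤ᵇ countGe y M then y else 0) (upTo (suc (length M))))

  Hsup : ℕ → Fin N → Fin N → ℕ
  Hsup zero    u v = supp u v
  Hsup (suc n) u v =
    hIndex (map (λ w → Pfrom (Hsup n) u w ⊓ Pfrom (Hsup n) v w) (common u v))

{-# OPTIONS --safe #-}
module Submission where

-- Both ingredients of the recursion are monotone: the bottleneck value P is
-- monotone in the edge weights it is computed from, and the H-index is
-- monotone under a pointwise increase of a multiset of fixed size.  So
-- H⁽ⁿ⁺¹⁾sup ≤ H⁽ⁿ⁾sup follows by induction on n from the base case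
-- H⁽¹⁾sup(e) ≤ sup(e) = |△(e,h)|, which holds because an H-index never
-- exceeds the size of its multiset.

open import Defs
open import Data.Bool using (true; false; if_then_else_)
open import Data.Fin using (Fin)
open import Data.List using ([]; _∷_; map; foldr; length; upTo)
open import Data.List.Properties using (length-map; length-filter)
open import Data.List.Relation.Binary.Pointwise as Pointwise using (Pointwise; []; _∷_; Pointwise-length)
open import Data.Nat using (ℕ; zero; suc; _≤_; _⊓_; _⊔_; _≤ᵇ_; z≤n; s≤s)
open import Data.Nat.Properties using (≤ᵇ-reflects-≤; ≤-refl; ≤-trans; module ≤-Reasoning; m≤n⇒m≤1+n; ⊓-mono-≤; ⊔-mono-≤; ⊔-lub)
open import Relation.Binary.PropositionalEquality using (_≡_)
open import Relation.Nullary using (contradiction)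
open import Relation.Nullary.Reflects using (ofʸ; ofⁿ)

max-map-mono : ∀ {A : Set} {f g : A → ℕ} → (∀ x → f x ≤ g x) →
               ∀ xs → foldr _⊔_ 0 (map f xs) ≤ foldr _⊔_ 0 (map g xs)
max-map-mono f≤g []       = z≤n
max-map-mono f≤g (x ∷ xs) = ⊔-mono-≤ (f≤g x) (max-map-mono f≤g xs)

max-map-≤ : ∀ {A : Set} {f : A → ℕ} {b : ℕ} → (∀ x → f x ≤ b) →
            ∀ xs → foldr _⊔_ 0 (map f xs) ≤ b
max-map-≤ f≤b []       = z≤n
max-map-≤ f≤b (x ∷ xs) = ⊔-lub (f≤b x) (max-map-≤ f≤b xs)

if-≤ᵇ-≤ : ∀ y c → (if y ≤ᵇ c then y else 0) ≤ c
if-≤ᵇ-≤ y c with y ≤ᵇ c | ≤ᵇ-reflects-≤ y c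
... | true  | ofʸ y≤c = y≤c
... | false | _       = z≤n

if-≤ᵇ-mono : ∀ y {c c'} → c ≤ c' → (if y ≤ᵇ c then y else 0) ≤ (if y ≤ᵇ c' then y else 0)
if-≤ᵇ-mono y {c} {c'} c≤c' with y ≤ᵇ c | ≤ᵇ-reflects-≤ y c | y ≤ᵇ c' | ≤ᵇ-reflects-≤ y c'
... | false | _       | _     | _         = z≤n
... | true  | _       | true  | _         = ≤-refl
... | true  | ofʸ y≤c | false | ofⁿ y≰c' = contradiction (≤-trans y≤c c≤c') y≰c'

module _ (G : Graph) (h : ℕ) where
  open Graph G

  bottleneck-mono : ∀ {f g : Fin N → Fin N → ℕ} → (∀ x y → f x y ≤ g x y) →
                    ∀ p → bottleneck G h f p ≤ bottleneck G h g p
  bottleneck-mono f≤g []               = z≤n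
  bottleneck-mono f≤g (x ∷ [])         = z≤n
  bottleneck-mono f≤g (x ∷ y ∷ [])     = f≤g x y
  bottleneck-mono f≤g (x ∷ y ∷ z ∷ zs) = ⊓-mono-≤ (f≤g x y) (bottleneck-mono f≤g (y ∷ z ∷ zs))

  Pfrom-mono : ∀ {f g : Fin N → Fin N → ℕ} → (∀ x y → f x y ≤ g x y) →
               ∀ a b → Pfrom G h f a b ≤ Pfrom G h g a b
  Pfrom-mono f≤g a b = max-map-mono (bottleneck-mono f≤g) (paths G h a b)

  countGe-mono : ∀ y {M M'} → Pointwise _≤_ M M' → countGe G h y M ≤ countGe G h y M'
  countGe-mono y [] = z≤n
  countGe-mono y (_∷_ {m} {m'} m≤m' M≤M')
    with y ≤ᵇ m | ≤ᵇ-reflects-≤ y m | y ≤ᵇ m' | ≤ᵇ-reflects-≤ y m'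
  ... | true  | _       | true  | _         = s≤s (countGe-mono y M≤M')
  ... | true  | ofʸ y≤m | false | ofⁿ y≰m' = contradiction (≤-trans y≤m m≤m') y≰m'
  ... | false | _       | true  | _         = m≤n⇒m≤1+n (countGe-mono y M≤M')
  ... | false | _       | false | _         = countGe-mono y M≤M'

  hIndex-≤-length : ∀ M → hIndex G h M ≤ length M
  hIndex-≤-length M = max-map-≤ (λ y → ≤-trans (if-≤ᵇ-≤ y _) (length-filter _ M)) (upTo (suc (length M)))

  hIndex-mono : ∀ {M M'} → Pointwise _≤_ M M' → hIndex G h M ≤ hIndex G h M'
  hIndex-mono {M' = M'} M≤M' rewrite Pointwise-length M≤M' =
    max-map-mono (λ y → if-≤ᵇ-mono y (countGe-mono y M≤M')) (upTo (suc (length M')))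

  commonValue : ℕ → Fin N → Fin N → Fin N → ℕ
  commonValue k u v w = Pfrom G h (Hsup G h k) u w ⊓ Pfrom G h (Hsup G h k) v w

  Hsup-suc-≤ : ∀ n u v → Hsup G h (suc n) u v ≤ Hsup G h n u v
  Hsup-suc-≤ zero u v = begin
    hIndex G h (map (commonValue 0 u v) (common G h u v))
      ≤⟨ hIndex-≤-length (map (commonValue 0 u v) (common G h u v)) ⟩
    length (map (commonValue 0 u v) (common G h u v))
      ≡⟨ length-map (commonValue 0 u v) (common G h u v) ⟩
    supp G h u v
      ∎
    where open ≤-Reasoning
  Hsup-suc-≤ (suc n) u v = hIndex-mono
    (Pointwise.map⁺ (commonValue (suc n) u v) (commonValue n u v)
      (Pointwise.refl commonValue-mono {common G h u v}))
    where
      commonValue-mono : ∀ {w} → commonValue (suc n) u v w ≤ commonValue n u v w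
      commonValue-mono {w} = ⊓-mono-≤ (Pfrom-mono (Hsup-suc-≤ n) u w) (Pfrom-mono (Hsup-suc-≤ n) v w)

theorem1 : (G : Graph) (h : ℕ) → 1 ≤ h → (n : ℕ) → 1 ≤ n →
    (u v : Fin (Graph.N G)) → Graph.adj G u v ≡ true →
    Hsup G h (suc n) u v ≤ Hsup G h n u v
theorem1 G h _ n _ u v _ = Hsup-suc-≤ G h n u v
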